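{- Let $n \ge 1$, $1 \le k \le n$, $m = n + k$, and let $\phi_1,\dots,\phi_n : \mathbf{F}_2^m \to \mathbf{F}_2^2$ be $\mathbf{F}_2$-linear maps with $\bigcap_{i=1}^n \ker(\phi_i) = \{0\}$. Then there exist indices $i_1,\dots,i_k$ such that the map $\phi_{i_1}\times\cdots\times\phi_{i_k} : \mathbf{F}_2^m \to (\mathbf{F}_2^2)^k$, $v \mapsto (\phi_{i_1}(v),\dots,\phi_{i_k}(v))$, is surjective. -}

module Defs where

open import Data.Bool using (Bool; false; true; _xor_)
open import Data.Nat using (ℕ)
open import Data.Vec using (Vec; zipWith; replicate)
open import Relation.Binary.PropositionalEquality using (_≡_)

-- F₂ is modelled by Bool with addition _xor_; F₂^m is Vec Bool m.
F₂^ : ℕ → Set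
F₂^ m = Vec Bool m

0v : ∀ {m} → F₂^ m
0v {m} = replicate m false

_⊕_ : ∀ {m} → F₂^ m → F₂^ m → F₂^ m
_⊕_ = zipWith _xor_

-- F₂-linearity: over F₂ the only scalars are 0 and 1, so linearity is
-- additivity plus preservation of zero (scalar 0).
record IsLinear {a b : ℕ} (f : F₂^ a → F₂^ b) : Set where
  field
    map-0 : f 0v ≡ 0v
    map-⊕ : ∀ u v → f (u ⊕ v) ≡ f u ⊕ f v

-- Choose greedily a list S of indices with φ_S := (φ_i)_{i ∈ S} surjective, adding an
-- index j whenever φ_j maps ker φ_S onto F₂². A rejected j maps ker φ_S onto a proper
-- subspace of F₂², which has at most one nonzero vector; so on ker φ_S the value of φ_j
-- is fixed by one bit, and, splitting v = (v − σ(φ_S v)) + σ(φ_S v) along a section σ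
-- of φ_S, φ_j v is fixed by φ_S v and that bit. As the φ_i are jointly injective, v is
-- then encoded injectively by 2|S| + (n − |S|) bits, whence n + k ≤ n + |S|.
module Submission where

open import Defs
open import Data.Bool using (Bool; _∨_)
import Data.Bool.Properties as Bool
open import Data.Nat using (ℕ; suc; _+_; _*_; _^_; _≤_; z≤n; s≤s)
open import Data.Nat.Properties
  using (+-suc; n<1+n; ^-monoʳ-<; ≮⇒≥; <⇒≱; m≤n⇒m<n∨m≡n; +-cancelˡ-≤; ≤-trans;
         ≤-refl)
open import Data.Nat.Tactic.RingSolver using (solve-∀)
open import Data.Fin using (Fin)
import Data.Fin.Properties as Fin
open import Data.Product using (Σ; ∃; _×_; _,_; proj₁; proj₂)
open import Data.Sum using (_⊎_; inj₁; inj₂; [_,_]′)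
import Data.Sum as Sum
open import Data.Vec
  using (Vec; []; _∷_; _++_; map; concat; lookup; tabulate; allFin; splitAt)
open import Data.Vec.Properties
  using (≡-dec; zipWith-assoc; zipWith-identityˡ; zipWith-identityʳ; zipWith-++;
         ++-injectiveˡ; ++-injectiveʳ; ∷-injectiveˡ; ∷-injectiveʳ; lookup-map; lookup∘tabulate)
open import Data.Vec.Membership.Propositional using (_∈_)
open import Data.Vec.Membership.Propositional.Properties using (∈-allFin⁺)
open import Data.Vec.Relation.Unary.Any using (here; there)
import Data.Vec.Recursive as Rec
open import Data.Vec.Recursive.Properties using (↔Vec)
open import Function using (_∘_; _↔_; Inverse; Injection)
open import Function.Properties.Inverse using (↔-sym; ↔-trans; ↔⇒↣)
open import Relation.Binary.PropositionalEquality
  using (_≡_; refl; sym; trans; cong; cong₂; subst; module ≡-Reasoning)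
open import Relation.Nullary using (¬_; Dec; yes; no; contradiction)
open import Relation.Nullary.Decidable using (map′; ¬?; _×-dec_; _⊎-dec_; _→-dec_; from-yes)
open import Relation.Unary using (Decidable)

open ≡-Reasoning

concat-injective : ∀ {A : Set} {s t} (xss yss : Vec (Vec A t) s) →
  concat xss ≡ concat yss → xss ≡ yss
concat-injective []         []         _ = refl
concat-injective (xs ∷ xss) (ys ∷ yss) e =
  cong₂ _∷_ (++-injectiveˡ xs ys e) (concat-injective xss yss (++-injectiveʳ xs ys e))

map-≡-on-∈ : ∀ {A B : Set} {t} {f g : A → B} {x} {xs : Vec A t} →
  map f xs ≡ map g xs → x ∈ xs → f x ≡ g x
map-≡-on-∈ e (here refl) = ∷-injectiveˡ e
map-≡-on-∈ e (there x∈xs) = map-≡-on-∈ (∷-injectiveʳ e) x∈xs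

⊕-identityˡ : ∀ {m} (u : F₂^ m) → 0v ⊕ u ≡ u
⊕-identityˡ = zipWith-identityˡ Bool.xor-identityˡ

⊕-identityʳ : ∀ {m} (u : F₂^ m) → u ⊕ 0v ≡ u
⊕-identityʳ = zipWith-identityʳ Bool.xor-identityʳ

⊕-assoc : ∀ {m} (u v w : F₂^ m) → (u ⊕ v) ⊕ w ≡ u ⊕ (v ⊕ w)
⊕-assoc = zipWith-assoc Bool.xor-assoc

⊕-self : ∀ {m} (u : F₂^ m) → u ⊕ u ≡ 0v
⊕-self []      = refl
⊕-self (b ∷ u) = cong₂ _∷_ (Bool.xor-same b) (⊕-self u)

u⊕[u⊕v]≡v : ∀ {m} (u v : F₂^ m) → u ⊕ (u ⊕ v) ≡ v
u⊕[u⊕v]≡v u v = begin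
  u ⊕ (u ⊕ v) ≡⟨ ⊕-assoc u u v ⟨
  (u ⊕ u) ⊕ v ≡⟨ cong (_⊕ v) (⊕-self u) ⟩
  0v ⊕ v      ≡⟨ ⊕-identityˡ v ⟩
  v           ∎

[u⊕v]⊕v≡u : ∀ {m} (u v : F₂^ m) → (u ⊕ v) ⊕ v ≡ u
[u⊕v]⊕v≡u u v = begin
  (u ⊕ v) ⊕ v ≡⟨ ⊕-assoc u v v ⟩
  u ⊕ (v ⊕ v) ≡⟨ cong (u ⊕_) (⊕-self v) ⟩
  u ⊕ 0v      ≡⟨ ⊕-identityʳ u ⟩
  u           ∎

⊕-cancelʳ : ∀ {m} {u v : F₂^ m} (w : F₂^ m) → u ⊕ w ≡ v ⊕ w → u ≡ v
⊕-cancelʳ {u = u} {v} w e = begin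
  u           ≡⟨ [u⊕v]⊕v≡u u w ⟨
  (u ⊕ w) ⊕ w ≡⟨ cong (_⊕ w) e ⟩
  (v ⊕ w) ⊕ w ≡⟨ [u⊕v]⊕v≡u v w ⟩
  v           ∎

⊕≡0v⇒≡ : ∀ {m} {u v : F₂^ m} → u ⊕ v ≡ 0v → u ≡ v
⊕≡0v⇒≡ {v = v} e = ⊕-cancelʳ v (trans e (sym (⊕-self v)))

module _ {a b} {f : F₂^ a → F₂^ b} (f-linear : IsLinear f) where
  open IsLinear f-linear

  linear-kernel-⊕ : ∀ {u v} → f u ≡ 0v → f v ≡ 0v → f (u ⊕ v) ≡ 0v
  linear-kernel-⊕ {u} {v} fu≡0 fv≡0 = begin
    f (u ⊕ v)  ≡⟨ map-⊕ u v ⟩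
    f u ⊕ f v  ≡⟨ cong₂ _⊕_ fu≡0 fv≡0 ⟩
    0v ⊕ 0v    ≡⟨ ⊕-self 0v ⟩
    0v         ∎

  linear-cancelʳ : ∀ {u v} w → f (u ⊕ w) ≡ f (v ⊕ w) → f u ≡ f v
  linear-cancelʳ {u} {v} w e = ⊕-cancelʳ (f w) (begin
    f u ⊕ f w  ≡⟨ map-⊕ u w ⟨
    f (u ⊕ w)  ≡⟨ e ⟩
    f (v ⊕ w)  ≡⟨ map-⊕ v w ⟩
    f v ⊕ f w  ∎)

_≟_ : ∀ {m} (u v : F₂^ m) → Dec (u ≡ v)
_≟_ = ≡-dec Bool._≟_

F₂^↔Fin : ∀ m → F₂^ m ↔ Fin (2 ^ m)
F₂^↔Fin m =
  ↔-sym (↔-trans (Rec.Fin[m^n]↔Fin[m]^n 2 m) (↔-trans (Rec.lift↔ m Fin.2↔Bool) (↔Vec m)))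

module _ {m : ℕ} where
  open Inverse (F₂^↔Fin m)

  any? : ∀ {P : F₂^ m → Set} → Decidable P → Dec (∃ P)
  any? {P} P? = map′ (λ (i , p) → from i , p)
                     (λ (u , p) → to u , subst P (sym (strictlyInverseʳ u)) p)
                     (Fin.any? (P? ∘ from))

  all? : ∀ {P : F₂^ m → Set} → Decidable P → Dec (∀ u → P u)
  all? {P} P? = map′ (λ h u → subst P (strictlyInverseʳ u) (h (to u)))
                     (λ h i → h (from i))
                     (Fin.all? (P? ∘ from))

injective⇒≤ : ∀ {m l} (f : F₂^ m → F₂^ l) → (∀ {u v} → f u ≡ f v → u ≡ v) → m ≤ l
injective⇒≤ {m} {l} f f-injective = ≮⇒≥ λ l<m →
  <⇒≱ (^-monoʳ-< 2 (n<1+n 1) l<m)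
      (Fin.injective⇒≤ {f = Fₗ.to ∘ f ∘ Fₘ.to} (Fₘ.injective ∘ f-injective ∘ Fₗ.injective))
  where
  module Fₘ = Injection (↔⇒↣ (↔-sym (F₂^↔Fin m)))
  module Fₗ = Injection (↔⇒↣ (F₂^↔Fin l))

isNonzero : F₂^ 2 → Bool
isNonzero (x ∷ y ∷ []) = x ∨ y

-- Distinct a, b with isNonzero a ≡ isNonzero b are both nonzero, so they span F₂².
two-nonzero-span : ∀ (a b w : F₂^ 2) → isNonzero a ≡ isNonzero b → ¬ a ≡ b →
  w ≡ 0v ⊎ w ≡ a ⊎ w ≡ b ⊎ w ≡ a ⊕ b
two-nonzero-span = from-yes (all? λ a → all? λ b → all? λ w →
  (isNonzero a Bool.≟ isNonzero b) →-dec (¬? (a ≟ b) →-dec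
    ((w ≟ 0v) ⊎-dec (w ≟ a) ⊎-dec (w ≟ b) ⊎-dec (w ≟ (a ⊕ b)))))

module _ {m n : ℕ} (φ : Fin n → F₂^ m → F₂^ 2) (φ-linear : ∀ i → IsLinear (φ i)) where

  φ[_] : ∀ {s} → Vec (Fin n) s → F₂^ m → F₂^ (s * 2)
  φ[ S ] v = concat (map (λ i → φ i v) S)

  φ[]-linear : ∀ {s} (S : Vec (Fin n) s) → IsLinear φ[ S ]
  φ[]-linear []      = record { map-0 = refl ; map-⊕ = λ _ _ → refl }
  φ[]-linear (i ∷ S) = record
    { map-0 = cong₂ _++_ (IsLinear.map-0 (φ-linear i)) (IsLinear.map-0 (φ[]-linear S))
    ; map-⊕ = λ u v → begin
        φ i (u ⊕ v) ++ φ[ S ] (u ⊕ v)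
          ≡⟨ cong₂ _++_ (IsLinear.map-⊕ (φ-linear i) u v) (IsLinear.map-⊕ (φ[]-linear S) u v) ⟩
        (φ i u ⊕ φ i v) ++ (φ[ S ] u ⊕ φ[ S ] v)
          ≡⟨ zipWith-++ _ (φ i u) (φ[ S ] u) (φ i v) (φ[ S ] v) ⟨
        φ[ i ∷ S ] u ⊕ φ[ i ∷ S ] v
          ∎ }

  φ[]-∈ : ∀ {s} {S : Vec (Fin n) s} {i u v} → i ∈ S → φ[ S ] u ≡ φ[ S ] v → φ i u ≡ φ i v
  φ[]-∈ {S = S} i∈S e = map-≡-on-∈ (concat-injective (map _ S) (map _ S) e) i∈S

  Surjective : ∀ {s} → Vec (Fin n) s → Set
  Surjective S = ∀ w → ∃ λ v → φ[ S ] v ≡ w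

  SurjectiveOnKernel : ∀ {s} → Vec (Fin n) s → Fin n → Set
  SurjectiveOnKernel S j = ∀ w → ∃ λ u → φ[ S ] u ≡ 0v × φ j u ≡ w

  surjectiveOnKernel? : ∀ {s} (S : Vec (Fin n) s) j → Dec (SurjectiveOnKernel S j)
  surjectiveOnKernel? S j = all? λ w → any? λ u → (φ[ S ] u ≟ 0v) ×-dec (φ j u ≟ w)

  surjective-[] : Surjective []
  surjective-[] [] = 0v , refl

  surjective-∷ : ∀ {s} {S : Vec (Fin n) s} {j} →
    Surjective S → SurjectiveOnKernel S j → Surjective (j ∷ S)
  surjective-∷ {S = S} {j} onto onto-ker w with splitAt 2 w
  ... | w₀ , w₁ , refl with onto w₁
  ... | v , φSv≡w₁ with onto-ker (φ j v ⊕ w₀)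
  ... | u , φSu≡0 , φju≡ = v ⊕ u , cong₂ _++_
    (begin
      φ j (v ⊕ u)          ≡⟨ IsLinear.map-⊕ (φ-linear j) v u ⟩
      φ j v ⊕ φ j u        ≡⟨ cong (φ j v ⊕_) φju≡ ⟩
      φ j v ⊕ (φ j v ⊕ w₀) ≡⟨ u⊕[u⊕v]≡v (φ j v) w₀ ⟩
      w₀                   ∎)
    (begin
      φ[ S ] (v ⊕ u)       ≡⟨ IsLinear.map-⊕ (φ[]-linear S) v u ⟩
      φ[ S ] v ⊕ φ[ S ] u  ≡⟨ cong₂ _⊕_ φSv≡w₁ φSu≡0 ⟩
      w₁ ⊕ 0v              ≡⟨ ⊕-identityʳ w₁ ⟩
      w₁                   ∎)

  surjective-∷⁻ : ∀ {s} {S : Vec (Fin n) s} {i} → Surjective (i ∷ S) → Surjective S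
  surjective-∷⁻ {i = i} onto w with onto (0v ++ w)
  ... | v , e = v , ++-injectiveʳ (φ i v) 0v e

  surjectiveOnKernel-∷⁻ : ∀ {s} {S : Vec (Fin n) s} {i j} →
    SurjectiveOnKernel (i ∷ S) j → SurjectiveOnKernel S j
  surjectiveOnKernel-∷⁻ {i = i} onto-ker w with onto-ker w
  ... | u , φiSu≡0 , φju≡w = u , ++-injectiveʳ (φ i u) 0v φiSu≡0 , φju≡w

  surjective-shrink : ∀ {k s} → k ≤ s → (S : Vec (Fin n) s) → Surjective S →
    Σ (Vec (Fin n) k) Surjective
  surjective-shrink z≤n [] onto = [] , onto
  surjective-shrink k≤s (i ∷ S) onto with m≤n⇒m<n∨m≡n k≤s
  ... | inj₂ refl       = i ∷ S , onto
  ... | inj₁ (s≤s k≤s′) = surjective-shrink k≤s′ S (surjective-∷⁻ {S = S} {i} onto)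

  surjective-pointwise : ∀ {s} {S : Vec (Fin n) s} → Surjective S →
    ∀ (w : Fin s → F₂^ 2) → ∃ λ v → ∀ j → φ (lookup S j) v ≡ w j
  surjective-pointwise {S = S} onto w with onto (concat (tabulate w))
  ... | v , e = v , λ j → begin
    φ (lookup S j) v                 ≡⟨ lookup-map j (λ i → φ i v) S ⟨
    lookup (map (λ i → φ i v) S) j
      ≡⟨ cong (λ x → lookup x j) (concat-injective (map (λ i → φ i v) S) (tabulate w) e) ⟩
    lookup (tabulate w) j            ≡⟨ lookup∘tabulate w j ⟩
    w j                              ∎

  isNonzero-injective-on-kernel : ∀ {s} {S : Vec (Fin n) s} {j x y} →
    ¬ SurjectiveOnKernel S j → φ[ S ] x ≡ 0v → φ[ S ] y ≡ 0v →
    isNonzero (φ j x) ≡ isNonzero (φ j y) → φ j x ≡ φ j y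
  isNonzero-injective-on-kernel {S = S} {j} {x} {y} ¬onto-ker x∈ker y∈ker same
    with φ j x ≟ φ j y
  ... | yes e = e
  ... | no ne = contradiction (λ w → preimage w (two-nonzero-span _ _ w same ne)) ¬onto-ker
    where
    preimage : ∀ w → w ≡ 0v ⊎ w ≡ φ j x ⊎ w ≡ φ j y ⊎ w ≡ φ j x ⊕ φ j y →
      ∃ λ u → φ[ S ] u ≡ 0v × φ j u ≡ w
    preimage w (inj₁ refl)               =
      0v , IsLinear.map-0 (φ[]-linear S) , IsLinear.map-0 (φ-linear j)
    preimage w (inj₂ (inj₁ refl))        = x , x∈ker , refl
    preimage w (inj₂ (inj₂ (inj₁ refl))) = y , y∈ker , refl
    preimage w (inj₂ (inj₂ (inj₂ refl))) =
      x ⊕ y , linear-kernel-⊕ (φ[]-linear S) x∈ker y∈ker , IsLinear.map-⊕ (φ-linear j) x y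

  record Partition {t} (L : Vec (Fin n) t) : Set where
    field
      s r       : ℕ
      chosen    : Vec (Fin n) s
      rejected  : Vec (Fin n) r
      size      : s + r ≡ t
      chosen-surjective : Surjective chosen
      rejected-not-surjectiveOnKernel : ∀ {j} → j ∈ rejected → ¬ SurjectiveOnKernel chosen j
      covers    : ∀ {i} → i ∈ L → i ∈ chosen ⊎ i ∈ rejected

  greedy : ∀ {t} (L : Vec (Fin n) t) → Partition L
  greedy [] = record
    { s = 0 ; r = 0 ; chosen = [] ; rejected = [] ; size = refl
    ; chosen-surjective = surjective-[]
    ; rejected-not-surjectiveOnKernel = λ ()
    ; covers = λ () }
  greedy (j ∷ L) with P ← greedy L | surjectiveOnKernel? (Partition.chosen P) j
  ... | yes onto-ker = record
    { s = suc s ; r = r ; chosen = j ∷ chosen ; rejected = rejected ; size = cong suc size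
    ; chosen-surjective = surjective-∷ {S = chosen} chosen-surjective onto-ker
    ; rejected-not-surjectiveOnKernel = λ j∈R →
        rejected-not-surjectiveOnKernel j∈R ∘ surjectiveOnKernel-∷⁻ {S = chosen}
    ; covers = λ { (here refl) → inj₁ (here refl) ; (there i∈L) → Sum.map₁ there (covers i∈L) } }
    where open Partition P
  ... | no ¬onto-ker = record
    { s = s ; r = suc r ; chosen = chosen ; rejected = j ∷ rejected
    ; size = trans (+-suc s r) (cong suc size)
    ; chosen-surjective = chosen-surjective
    ; rejected-not-surjectiveOnKernel = λ
        { (here refl) → ¬onto-ker ; (there j∈R) → rejected-not-surjectiveOnKernel j∈R }
    ; covers = λ { (here refl) → inj₂ (here refl) ; (there i∈L) → Sum.map₂ there (covers i∈L) } }
    where open Partition P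

  module _ (kernel-trivial : ∀ v → (∀ i → φ i v ≡ 0v) → v ≡ 0v) where

    dimension-bound : ∀ {s r} (S : Vec (Fin n) s) (R : Vec (Fin n) r) → Surjective S →
      (∀ {j} → j ∈ R → ¬ SurjectiveOnKernel S j) → (∀ i → i ∈ S ⊎ i ∈ R) → m ≤ s * 2 + r
    dimension-bound {s} {r} S R onto R-not-onto-ker covers = injective⇒≤ encode encode-injective
      where
      σ : F₂^ (s * 2) → F₂^ m
      σ w = proj₁ (onto w)

      reduce : F₂^ m → F₂^ m
      reduce v = v ⊕ σ (φ[ S ] v)

      reduce-∈ker : ∀ v → φ[ S ] (reduce v) ≡ 0v
      reduce-∈ker v = begin
        φ[ S ] (v ⊕ σ (φ[ S ] v))          ≡⟨ IsLinear.map-⊕ (φ[]-linear S) v _ ⟩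
        φ[ S ] v ⊕ φ[ S ] (σ (φ[ S ] v))   ≡⟨ cong (φ[ S ] v ⊕_) (proj₂ (onto (φ[ S ] v))) ⟩
        φ[ S ] v ⊕ φ[ S ] v                ≡⟨ ⊕-self (φ[ S ] v) ⟩
        0v                                 ∎

      bit : Fin n → F₂^ m → Bool
      bit j v = isNonzero (φ j (reduce v))

      encode : F₂^ m → F₂^ (s * 2 + r)
      encode v = φ[ S ] v ++ map (λ j → bit j v) R

      encode-agree : ∀ {u v} → encode u ≡ encode v → ∀ i → φ i u ≡ φ i v
      encode-agree {u} {v} e i = [ (λ i∈S → φ[]-∈ i∈S φSu≡φSv) , rejected-agree ]′ (covers i)
        where
        φSu≡φSv : φ[ S ] u ≡ φ[ S ] v
        φSu≡φSv = ++-injectiveˡ (φ[ S ] u) (φ[ S ] v) e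
        reduce-v : reduce v ≡ v ⊕ σ (φ[ S ] u)
        reduce-v = cong (λ w → v ⊕ σ w) (sym φSu≡φSv)
        rejected-agree : i ∈ R → φ i u ≡ φ i v
        rejected-agree i∈R = linear-cancelʳ (φ-linear i) (σ (φ[ S ] u))
          (isNonzero-injective-on-kernel {S = S} (R-not-onto-ker i∈R) (reduce-∈ker u)
            (subst (λ x → φ[ S ] x ≡ 0v) reduce-v (reduce-∈ker v))
            (trans (map-≡-on-∈ (++-injectiveʳ (φ[ S ] u) (φ[ S ] v) e) i∈R)
                   (cong (isNonzero ∘ φ i) reduce-v)))

      encode-injective : ∀ {u v} → encode u ≡ encode v → u ≡ v
      encode-injective {u} {v} e = ⊕≡0v⇒≡ (kernel-trivial (u ⊕ v) λ i → begin
        φ i (u ⊕ v)    ≡⟨ IsLinear.map-⊕ (φ-linear i) u v ⟩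
        φ i u ⊕ φ i v  ≡⟨ cong (_⊕ φ i v) (encode-agree e i) ⟩
        φ i v ⊕ φ i v  ≡⟨ ⊕-self (φ i v) ⟩
        0v             ∎)

    surjective-subfamily : ∀ {k} → n + k ≤ m → Σ (Vec (Fin n) k) Surjective
    surjective-subfamily {k} n+k≤m = surjective-shrink k≤s chosen chosen-surjective
      where
      open Partition (greedy (allFin n))
      2s+r≡n+s : s * 2 + r ≡ n + s
      2s+r≡n+s = trans (s*2+r≡s+r+s s r) (cong (_+ s) size)
        where
        s*2+r≡s+r+s : ∀ s r → s * 2 + r ≡ s + r + s
        s*2+r≡s+r+s = solve-∀
      m≤n+s : m ≤ n + s
      m≤n+s = subst (m ≤_) 2s+r≡n+s (dimension-bound chosen rejected chosen-surjective
        rejected-not-surjectiveOnKernel (covers ∘ ∈-allFin⁺))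
      k≤s : k ≤ s
      k≤s = +-cancelˡ-≤ n k s (≤-trans n+k≤m m≤n+s)

lemma5p4 : (n k : ℕ) → 1 ≤ n → 1 ≤ k → k ≤ n →
    (φ : Fin n → F₂^ (n + k) → F₂^ 2) →
    (∀ i → IsLinear (φ i)) →
    (∀ (v : F₂^ (n + k)) → (∀ i → φ i v ≡ 0v) → v ≡ 0v) →
    Σ (Fin k → Fin n) λ ι →
    ∀ (w : Fin k → F₂^ 2) → ∃ λ (v : F₂^ (n + k)) → ∀ j → φ (ι j) v ≡ w j
lemma5p4 n k _ _ _ φ φ-linear kernel-trivial
  with S , onto ← surjective-subfamily φ φ-linear kernel-trivial ≤-refl
  = lookup S , surjective-pointwise φ φ-linear {S = S} onto
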